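{- Let $n\geqslant 3$ and let $u$ be any vertex of degree $2$ on the path $P_n$. Then there exists a strongly antimagic labeling $f$ of $P_n$ such that $\phi_f(u)=\max\{\phi_f(w):\deg(w)=2\}$.
   Context: For a graph with $m$ edges, an antimagic labeling is a bijection $f:E\to\{1,\ldots,m\}$ such that the vertex sums $\phi_f(x)=\sum_{e\ni x}f(e)$ are pairwise distinct. A strongly antimagic labeling is an antimagic labeling with $\phi_f(x)>\phi_f(y)$ whenever $\deg(x)>\deg(y)$. -}

module Defs where

open import Data.Nat using (ℕ; zero; suc; _∸_; _<_; _>_)
open import Data.Fin using (Fin; toℕ; inject₁; fromℕ<) renaming (suc to fsuc)
open import Data.Fin.Properties using (_≟_)
open import Data.Bool using (Bool; true; _∨_)
import Data.Bool.Properties as B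
open import Data.Nat.ListAction using (sum)
open import Data.List using (map; filter; length; allFin)
open import Data.Product using (_×_)
open import Relation.Binary.PropositionalEquality using (_≡_)
open import Relation.Nullary using (¬_)
open import Relation.Nullary.Decidable using (⌊_⌋)
open import Function.Definitions using (Bijective)

record Graph : Set where
  field
    V     : ℕ
    m     : ℕ
    end₁  : Fin m → Fin V
    end₂  : Fin m → Fin V

open Graph public

incident : (G : Graph) → Fin (m G) → Fin (V G) → Bool
incident G e x = ⌊ end₁ G e ≟ x ⌋ ∨ ⌊ end₂ G e ≟ x ⌋

incEdges : (G : Graph) (x : Fin (V G)) → Data.List.List (Fin (m G))
incEdges G x = filter (λ e → incident G e x B.≟ true) (allFin (m G))

deg : (G : Graph) → Fin (V G) → ℕ
deg G x = length (incEdges G x)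

-- An edge labeling with labels {1,…,m} is encoded by a map
-- g : Fin m → Fin m, the label of e being toℕ (g e) + 1.
label : {k : ℕ} → (Fin k → Fin k) → Fin k → ℕ
label g e = suc (toℕ (g e))

φ : (G : Graph) → (Fin (m G) → Fin (m G)) → Fin (V G) → ℕ
φ G g x = sum (map (label g) (incEdges G x))

IsAntimagic : (G : Graph) → (Fin (m G) → Fin (m G)) → Set
IsAntimagic G g =
  Bijective _≡_ _≡_ g ×
  (∀ x y → ¬ (x ≡ y) → ¬ (φ G g x ≡ φ G g y))

IsStronglyAntimagic : (G : Graph) → (Fin (m G) → Fin (m G)) → Set
IsStronglyAntimagic G g =
  IsAntimagic G g ×
  (∀ x y → deg G x > deg G y → φ G g x > φ G g y)

Path : ℕ → Graph
Path n = record { V = n ; m = n ∸ 1 ; end₁ = e₁ n ; end₂ = e₂ n }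
  where
    e₁ : (n : ℕ) → Fin (n ∸ 1) → Fin n
    e₁ zero ()
    e₁ (suc k) i = inject₁ i
    e₂ : (n : ℕ) → Fin (n ∸ 1) → Fin n
    e₂ zero ()
    e₂ (suc k) i = fsuc i

-- Edge labels are handled as sequences a 0, …, a (m-1) along P_{m+1}. For the peak at the
-- first inner vertex the zigzag ⌈m/2⌉, m, ⌈m/2⌉-1, m-1, … works: consecutive vertex sums
-- decrease by one and all exceed both end labels. Inserting a new largest label m+1 between
-- the two edges at the peak preserves all the requirements, and the peak moves to the end of
-- the new edge whose other edge carries the larger old label. The orientation alternates, so two
-- insertions move the peak one vertex to the right; this reaches every u ≤ m/2, and reversing
-- the path covers the remaining vertices.
{-# OPTIONS --safe #-}
module Submission where

open import Defs
open import Data.Nat using (ℕ; zero; suc; _+_; _∸_; _≤_; _<_; _≥_; _>_; z≤n; s≤s; s≤s⁻¹; pred; _≤?_; >-nonZero)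
open import Data.Nat.Properties
open import Data.Nat.ListAction using (sum)
open import Data.Nat.Solver using (module +-*-Solver)
open import Data.Bool using (Bool; true; false; if_then_else_)
import Data.Bool.Properties as Bool
open import Data.Fin using (Fin; toℕ; fromℕ<; inject₁; punchOut) renaming (zero to fzero; suc to fsuc)
import Data.Fin.Properties as Finₚ
open import Data.List using (List; []; _∷_; map; filter; length; tabulate; allFin)
open import Data.List.Properties using (tabulate-cong; map-tabulate; map-cong)
open import Data.Product using (Σ; _×_; _,_)
open import Data.Sum using (inj₁; inj₂)
open import Data.Empty using (⊥-elim)
open import Function using (_∘_)
open import Function.Definitions using (Injective; Surjective)
open import Relation.Binary using (tri<; tri≈; tri>)
open import Relation.Binary.PropositionalEquality
open import Relation.Nullary using (yes; no)
open import Relation.Nullary.Negation using (contradiction)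

open +-*-Solver using (solve; _:+_; _:=_)

pred[n]<n : ∀ {n} → 1 ≤ n → pred n < n
pred[n]<n {suc n} _ = ≤-refl

innerSum : (ℕ → ℕ) → ℕ → ℕ
innerSum a x = a (pred x) + a x

-- the w-label of the edge left, resp. right, of vertex x of P_{M+1}, or 0 if there is none
leftLabel : (ℕ → ℕ) → ℕ → ℕ
leftLabel w zero = 0
leftLabel w (suc x) = w x

rightLabel : ℕ → (ℕ → ℕ) → ℕ → ℕ
rightLabel zero w x = 0
rightLabel (suc M) w zero = w 0
rightLabel (suc M) w (suc x) = rightLabel M (w ∘ suc) x

pathSum : ℕ → (ℕ → ℕ) → ℕ → ℕ
pathSum M w x = leftLabel w x + rightLabel M w x

data Position (M x : ℕ) : Set where
  start : x ≡ 0 → Position M x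
  inner : 1 ≤ x → x < M → Position M x
  end   : x ≡ M → Position M x

position : ∀ M x → x ≤ M → Position M x
position M zero _ = start refl
position M (suc x) x<M with m≤n⇒m<n∨m≡n x<M
... | inj₁ x<M = inner (s≤s z≤n) x<M
... | inj₂ x≡M = end x≡M

rightLabel-< : ∀ M w x → x < M → rightLabel M w x ≡ w x
rightLabel-< (suc M) w zero _ = refl
rightLabel-< (suc M) w (suc x) x<M = rightLabel-< M (w ∘ suc) x (s≤s⁻¹ x<M)

rightLabel-≥ : ∀ M w x → M ≤ x → rightLabel M w x ≡ 0
rightLabel-≥ zero w x _ = refl
rightLabel-≥ (suc M) w (suc x) M≤x = rightLabel-≥ M _ x (s≤s⁻¹ M≤x)

pathSum-start : ∀ M w → 1 ≤ M → pathSum M w 0 ≡ w 0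
pathSum-start M w 1≤M = rightLabel-< M w 0 1≤M

pathSum-inner : ∀ M w x → 1 ≤ x → x < M → pathSum M w x ≡ innerSum w x
pathSum-inner M w (suc x) _ x<M = cong (w x +_) (rightLabel-< M w (suc x) x<M)

pathSum-end : ∀ M w → 1 ≤ M → pathSum M w M ≡ w (pred M)
pathSum-end (suc M) w _ = trans (cong (w M +_) (rightLabel-≥ (suc M) w (suc M) ≤-refl)) (+-identityʳ (w M))

degree : ℕ → ℕ → ℕ
degree M = pathSum M (λ _ → 1)

1≤degree : ∀ M x → 1 ≤ M → x ≤ M → 1 ≤ degree M x
1≤degree M x 1≤M x≤M with position M x x≤M
... | start refl    = ≤-reflexive (sym (pathSum-start M _ 1≤M))
... | end refl      = ≤-reflexive (sym (pathSum-end M _ 1≤M))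
... | inner 1≤x x<M = ≤-trans (s≤s z≤n) (≤-reflexive (sym (pathSum-inner M _ x 1≤x x<M)))

degree≡2⇒inner : ∀ M x → 1 ≤ M → x ≤ M → degree M x ≡ 2 → 1 ≤ x × x < M
degree≡2⇒inner M x 1≤M x≤M deg≡2 with position M x x≤M
... | start refl    = contradiction (trans (sym (pathSum-start M _ 1≤M)) deg≡2) λ ()
... | end refl      = contradiction (trans (sym (pathSum-end M _ 1≤M)) deg≡2) λ ()
... | inner 1≤x x<M = 1≤x , x<M

sum-map-filter : ∀ {A : Set} (P : A → Bool) (w : A → ℕ) (xs : List A) →
  sum (map w (filter (λ x → P x Bool.≟ true) xs)) ≡ sum (map (λ x → if P x then w x else 0) xs)
sum-map-filter P w [] = refl
sum-map-filter P w (x ∷ xs) with P x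
... | true  = cong (w x +_) (sum-map-filter P w xs)
... | false = sum-map-filter P w xs

length≡sum-map-1 : ∀ {A : Set} (xs : List A) → length xs ≡ sum (map (λ _ → 1) xs)
length≡sum-map-1 [] = refl
length≡sum-map-1 (x ∷ xs) = cong suc (length≡sum-map-1 xs)

sum-tabulate-0 : ∀ M → sum (tabulate {n = M} (λ _ → 0)) ≡ 0
sum-tabulate-0 zero = refl
sum-tabulate-0 (suc M) = sum-tabulate-0 M

incident-suc : ∀ M (e : Fin M) (x : Fin (suc M)) →
  incident (Path (suc (suc M))) (fsuc e) (fsuc x) ≡ incident (Path (suc M)) e x
incident-suc M e x with inject₁ e Finₚ.≟ x | fsuc e Finₚ.≟ x
... | yes _ | yes _ = refl
... | yes _ | no _  = refl
... | no _  | yes _ = refl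
... | no _  | no _  = refl

sum-tabulate-incident : ∀ M (w : ℕ → ℕ) (x : Fin (suc M)) →
  sum (tabulate (λ e → if incident (Path (suc M)) e x then w (toℕ e) else 0)) ≡ pathSum M w (toℕ x)
sum-tabulate-incident zero w fzero = refl
sum-tabulate-incident (suc M) w fzero =
  trans (cong (w 0 +_) (sum-tabulate-0 M)) (+-identityʳ (w 0))
sum-tabulate-incident (suc M) w (fsuc x) = begin
    first x + sum (tabulate rest)
      ≡⟨ cong (first x +_) (cong sum (tabulate-cong shift)) ⟩
    first x + sum (tabulate (λ e → if incident (Path (suc M)) e x then w (suc (toℕ e)) else 0))
      ≡⟨ cong (first x +_) (sum-tabulate-incident M (w ∘ suc) x) ⟩
    first x + (leftLabel (w ∘ suc) (toℕ x) + rightLabel M (w ∘ suc) (toℕ x))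
      ≡⟨ first-left x ⟩
    w (toℕ x) + rightLabel M (w ∘ suc) (toℕ x) ∎
  where
  open ≡-Reasoning
  first : Fin (suc M) → ℕ
  first x = if incident (Path (suc (suc M))) fzero (fsuc x) then w 0 else 0
  rest : Fin M → ℕ
  rest e = if incident (Path (suc (suc M))) (fsuc e) (fsuc x) then w (suc (toℕ e)) else 0
  shift : ∀ e → rest e ≡ (if incident (Path (suc M)) e x then w (suc (toℕ e)) else 0)
  shift e = cong (λ b → if b then w (suc (toℕ e)) else 0) (incident-suc M e x)
  first-left : ∀ x → first x + (leftLabel (w ∘ suc) (toℕ x) + rightLabel M (w ∘ suc) (toℕ x))
                       ≡ w (toℕ x) + rightLabel M (w ∘ suc) (toℕ x)
  first-left fzero = refl
  first-left (fsuc x) = refl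

sum-incEdges-Path : ∀ M (w : ℕ → ℕ) (x : Fin (suc M)) →
  sum (map (w ∘ toℕ) (incEdges (Path (suc M)) x)) ≡ pathSum M w (toℕ x)
sum-incEdges-Path M w x =
  trans (sum-map-filter (λ e → incident (Path (suc M)) e x) (w ∘ toℕ) (allFin M))
        (trans (cong sum (map-tabulate {n = M} (λ e → e) selected)) (sum-tabulate-incident M w x))
  where
  selected : Fin M → ℕ
  selected e = if incident (Path (suc M)) e x then w (toℕ e) else 0

deg-Path : ∀ M (x : Fin (suc M)) → deg (Path (suc M)) x ≡ degree M (toℕ x)
deg-Path M x = trans (length≡sum-map-1 (incEdges (Path (suc M)) x)) (sum-incEdges-Path M (λ _ → 1) x)

-- Edge i of P_{m+1}, joining vertices i and i + 1, is labelled a i.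
record PeakedLabeling (m u : ℕ) (a : ℕ → ℕ) : Set where
  field
    1≤u       : 1 ≤ u
    u<m       : u < m
    1≤label   : ∀ i → i < m → 1 ≤ a i
    label≤m   : ∀ i → i < m → a i ≤ m
    label-inj : ∀ i j → i < m → j < m → a i ≡ a j → i ≡ j
    sum-inj   : ∀ x y → 1 ≤ x → x < m → 1 ≤ y → y < m → innerSum a x ≡ innerSum a y → x ≡ y
    first<sum : ∀ x → 1 ≤ x → x < m → a 0 < innerSum a x
    last<sum  : ∀ x → 1 ≤ x → x < m → a (pred m) < innerSum a x
    sum≤peak  : ∀ x → 1 ≤ x → x < m → innerSum a x ≤ innerSum a u

  2≤m : 2 ≤ m
  2≤m = ≤-trans (s≤s 1≤u) u<m

module _ {M u a} (L : PeakedLabeling M u a) where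
  open PeakedLabeling L

  1≤M : 1 ≤ M
  1≤M = ≤-trans (s≤s z≤n) 2≤m

  first≢last : a 0 ≢ a (pred M)
  first≢last eq = <⇒≢ (suc[m]≤n⇒m≤pred[n] 2≤m) (label-inj 0 (pred M) 1≤M (pred[n]<n 1≤M) eq)

  start<inner : ∀ y → 1 ≤ y → y < M → pathSum M a 0 < pathSum M a y
  start<inner y 1≤y y<M = subst₂ _<_ (sym (pathSum-start M a 1≤M)) (sym (pathSum-inner M a y 1≤y y<M))
                                     (first<sum y 1≤y y<M)

  end<inner : ∀ y → 1 ≤ y → y < M → pathSum M a M < pathSum M a y
  end<inner y 1≤y y<M = subst₂ _<_ (sym (pathSum-end M a 1≤M)) (sym (pathSum-inner M a y 1≤y y<M))
                                   (last<sum y 1≤y y<M)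

  pathSum-injective : ∀ x y → x ≤ M → y ≤ M → pathSum M a x ≡ pathSum M a y → x ≡ y
  pathSum-injective x y x≤M y≤M eq with position M x x≤M | position M y y≤M
  ... | start refl | start refl = refl
  ... | end refl   | end refl   = refl
  ... | inner 1≤x x<M | inner 1≤y y<M =
    sum-inj x y 1≤x x<M 1≤y y<M (trans (sym (pathSum-inner M a x 1≤x x<M)) (trans eq (pathSum-inner M a y 1≤y y<M)))
  ... | start refl | end refl =
    ⊥-elim (first≢last (trans (sym (pathSum-start M a 1≤M)) (trans eq (pathSum-end M a 1≤M))))
  ... | end refl | start refl =
    ⊥-elim (first≢last (trans (sym (pathSum-start M a 1≤M)) (trans (sym eq) (pathSum-end M a 1≤M))))
  ... | start refl | inner 1≤y y<M = contradiction eq (<⇒≢ (start<inner y 1≤y y<M))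
  ... | end refl   | inner 1≤y y<M = contradiction eq (<⇒≢ (end<inner y 1≤y y<M))
  ... | inner 1≤x x<M | start refl = contradiction eq (>⇒≢ (start<inner x 1≤x x<M))
  ... | inner 1≤x x<M | end refl   = contradiction eq (>⇒≢ (end<inner x 1≤x x<M))

  degree<⇒pathSum< : ∀ x y → x ≤ M → y ≤ M → degree M x > degree M y → pathSum M a x > pathSum M a y
  degree<⇒pathSum< x y x≤M y≤M deg< with position M x x≤M | position M y y≤M
  ... | inner 1≤x x<M | start refl = start<inner x 1≤x x<M
  ... | inner 1≤x x<M | end refl   = end<inner x 1≤x x<M
  ... | inner 1≤x x<M | inner 1≤y y<M =
    contradiction deg< (<-irrefl (trans (pathSum-inner M _ y 1≤y y<M) (sym (pathSum-inner M _ x 1≤x x<M))))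
  ... | start refl | _ = contradiction (subst (degree M y <_) (pathSum-start M _ 1≤M) deg<)
                                      (≤⇒≯ (1≤degree M y 1≤M y≤M))
  ... | end refl   | _ = contradiction (subst (degree M y <_) (pathSum-end M _ 1≤M) deg<)
                                      (≤⇒≯ (1≤degree M y 1≤M y≤M))

  pathSum≤peak : ∀ x → x ≤ M → degree M x ≡ 2 → pathSum M a x ≤ pathSum M a u
  pathSum≤peak x x≤M deg≡2 =
    let 1≤x , x<M = degree≡2⇒inner M x 1≤M x≤M deg≡2
    in subst₂ _≤_ (sym (pathSum-inner M a x 1≤x x<M)) (sym (pathSum-inner M a u 1≤u u<m)) (sum≤peak x 1≤x x<M)

data EvenOdd : ℕ → Set where
  even : ∀ j → EvenOdd (j + j)
  odd  : ∀ j → EvenOdd (suc (j + j))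

evenOdd : ∀ i → EvenOdd i
evenOdd zero = even 0
evenOdd (suc i) with evenOdd i
... | even j = odd j
... | odd j  = subst EvenOdd (cong suc (+-suc j j)) (even (suc j))

j+j<q+q⇒j<q : ∀ j q → j + j < q + q → j < q
j+j<q+q⇒j<q j q j+j<q+q with q ≤? j
... | yes q≤j = contradiction (+-mono-≤ q≤j q≤j) (<⇒≱ j+j<q+q)
... | no  q≰j = ≰⇒> q≰j

zigzag : ℕ → ℕ → ℕ → ℕ
zigzag q h zero          = q
zigzag q h (suc zero)    = h
zigzag q h (suc (suc i)) = pred (zigzag q h i)

zigzag-even : ∀ q h j → zigzag q h (j + j) ≡ q ∸ j
zigzag-even q h zero = refl
zigzag-even q h (suc j) rewrite +-suc j j | zigzag-even q h j = pred[m∸n]≡m∸[1+n] q j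

zigzag-odd : ∀ q h j → zigzag q h (suc (j + j)) ≡ h ∸ j
zigzag-odd q h zero = refl
zigzag-odd q h (suc j) rewrite +-suc j j | zigzag-odd q h j = pred[m∸n]≡m∸[1+n] h j

[a∸j]+[b∸k]+[j+k]≡a+b : ∀ a b j k → j ≤ a → k ≤ b → (a ∸ j) + (b ∸ k) + (j + k) ≡ a + b
[a∸j]+[b∸k]+[j+k]≡a+b a b j k j≤a k≤b = begin
  (a ∸ j) + (b ∸ k) + (j + k)   ≡⟨ regroup (a ∸ j) (b ∸ k) j k ⟩
  ((a ∸ j) + j) + ((b ∸ k) + k) ≡⟨ cong₂ _+_ (m∸n+n≡m j≤a) (m∸n+n≡m k≤b) ⟩
  a + b                         ∎
  where
  open ≡-Reasoning
  regroup : ∀ x y j k → x + y + (j + k) ≡ (x + j) + (y + k)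
  regroup = solve 4 (λ x y j k → x :+ y :+ (j :+ k) := (x :+ j) :+ (y :+ k)) refl

module Zigzag (q r : ℕ) (1≤r : 1 ≤ r) (r≤q : r ≤ q) (q≤1+r : q ≤ suc r)
              (last≤ : zigzag q (q + r) (pred (q + r)) ≤ suc q) where
  n : ℕ
  n = q + r

  a : ℕ → ℕ
  a = zigzag q n

  even-< : ∀ j → j + j < n → j < q
  even-< j p = j+j<q+q⇒j<q j q (≤-trans p (+-monoʳ-≤ q r≤q))

  odd-<r : ∀ j → suc (j + j) < n → j < r
  odd-<r j p = j+j<q+q⇒j<q j r (s≤s⁻¹ (≤-trans p (+-monoˡ-≤ r q≤1+r)))

  odd-<n : ∀ j → suc (j + j) < n → j < n
  odd-<n j p = ≤-trans (s≤s (m≤m+n j j)) (<⇒≤ p)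

  -- labels at even positions lie in [1, q], labels at odd positions in (q, n]
  q<odd : ∀ j → j < r → q < n ∸ j
  q<odd j j<r = +-cancelʳ-< j q (n ∸ j)
    (subst (q + j <_) (sym (m∸n+n≡m (≤-trans (<⇒≤ j<r) (m≤n+m r q)))) (+-monoʳ-< q j<r))

  1≤label : ∀ i → i < n → 1 ≤ a i
  1≤label i p with evenOdd i
  ... | even j = subst (1 ≤_) (sym (zigzag-even q n j)) (m<n⇒0<n∸m (even-< j p))
  ... | odd j  = subst (1 ≤_) (sym (zigzag-odd q n j)) (m<n⇒0<n∸m (odd-<n j p))

  label≤m : ∀ i → i < n → a i ≤ n
  label≤m i p with evenOdd i
  ... | even j = subst (_≤ n) (sym (zigzag-even q n j)) (≤-trans (m∸n≤m q j) (m≤m+n q r))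
  ... | odd j  = subst (_≤ n) (sym (zigzag-odd q n j)) (m∸n≤m n j)

  label-inj : ∀ i i′ → i < n → i′ < n → a i ≡ a i′ → i ≡ i′
  label-inj i i′ p p′ eq with evenOdd i | evenOdd i′
  ... | even j | even j′ = cong (λ k → k + k) (∸-cancelˡ-≡ (<⇒≤ (even-< j p)) (<⇒≤ (even-< j′ p′))
          (trans (sym (zigzag-even q n j)) (trans eq (zigzag-even q n j′))))
  ... | odd j | odd j′ = cong (λ k → suc (k + k)) (∸-cancelˡ-≡ (<⇒≤ (odd-<n j p)) (<⇒≤ (odd-<n j′ p′))
          (trans (sym (zigzag-odd q n j)) (trans eq (zigzag-odd q n j′))))
  ... | even j | odd j′ = contradiction (trans (sym (zigzag-even q n j)) (trans eq (zigzag-odd q n j′)))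
          (<⇒≢ (≤-<-trans (m∸n≤m q j) (q<odd j′ (odd-<r j′ p′))))
  ... | odd j | even j′ = contradiction (trans (sym (zigzag-even q n j′)) (trans (sym eq) (zigzag-odd q n j)))
          (<⇒≢ (≤-<-trans (m∸n≤m q j′) (q<odd j (odd-<r j p))))

  sum+index : ∀ y → suc y < n → innerSum a (suc y) + y ≡ q + n
  sum+index y p with evenOdd y
  ... | even j = begin
    a (j + j) + a (suc (j + j)) + (j + j) ≡⟨ cong₂ (λ s t → s + t + (j + j)) (zigzag-even q n j) (zigzag-odd q n j) ⟩
    (q ∸ j) + (n ∸ j) + (j + j)          ≡⟨ [a∸j]+[b∸k]+[j+k]≡a+b q n j j j≤q j≤n ⟩
    q + n                                 ∎
    where
    open ≡-Reasoning
    j≤q : j ≤ q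
    j≤q = <⇒≤ (even-< j (<-trans (n<1+n _) p))
    j≤n : j ≤ n
    j≤n = <⇒≤ (odd-<n j p)
  ... | odd j = begin
    a (suc (j + j)) + a (suc (suc (j + j))) + suc (j + j)
      ≡⟨ cong₂ _+_ (cong₂ _+_ (zigzag-odd q n j) next-even) (sym (+-suc j j)) ⟩
    (n ∸ j) + (q ∸ suc j) + (j + suc j) ≡⟨ [a∸j]+[b∸k]+[j+k]≡a+b n q j (suc j) j≤n 1+j≤q ⟩
    n + q                               ≡⟨ +-comm n q ⟩
    q + n                               ∎
    where
    open ≡-Reasoning
    next-even : a (suc (suc (j + j))) ≡ q ∸ suc j
    next-even = trans (cong pred (zigzag-even q n j)) (pred[m∸n]≡m∸[1+n] q j)
    j≤n : j ≤ n
    j≤n = <⇒≤ (odd-<n j (<-trans (n<1+n _) p))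
    1+j≤q : suc j ≤ q
    1+j≤q = <⇒≤ (even-< (suc j) (subst (_< n) (cong suc (sym (+-suc j j))) p))

  2+q≤sum : ∀ y → suc y < n → 2 + q ≤ innerSum a (suc y)
  2+q≤sum y p = +-cancelʳ-≤ y (2 + q) (innerSum a (suc y))
    (subst₂ _≤_ (trans (+-suc q (suc y)) (cong suc (+-suc q y))) (sym (sum+index y p)) (+-monoʳ-≤ q p))

  zigzag-peaked : PeakedLabeling n 1 a
  zigzag-peaked = record
    { 1≤u       = s≤s z≤n
    ; u<m       = +-mono-≤ (≤-trans 1≤r r≤q) 1≤r
    ; 1≤label   = 1≤label
    ; label≤m   = label≤m
    ; label-inj = label-inj
    ; sum-inj   = λ { (suc x) (suc y) _ p _ p′ eq → cong suc (+-cancelˡ-≡ (innerSum a (suc x)) x y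
                     (trans (sum+index x p) (trans (sym (sum+index y p′)) (cong (_+ y) (sym eq))))) }
    ; first<sum = λ { (suc y) _ p → ≤-trans (n≤1+n _) (2+q≤sum y p) }
    ; last<sum  = λ { (suc y) _ p → ≤-trans (s≤s last≤) (2+q≤sum y p) }
    ; sum≤peak  = λ { (suc y) _ p → subst (innerSum a (suc y) ≤_) (sum+index y p) (m≤m+n _ y) }
    }

  ascending : a 0 < a 1
  ascending = subst (_< q + r) (+-identityʳ q) (+-monoʳ-< q 1≤r)

zigzagLabeling : ∀ m → 2 ≤ m → Σ (ℕ → ℕ) λ a → PeakedLabeling m 1 a × a 0 < a 1
zigzagLabeling m 2≤m with evenOdd m
zigzagLabeling .(suc k + suc k) _ | even (suc k) =
  let open Zigzag (suc k) (suc k) (s≤s z≤n) ≤-refl (n≤1+n _) last≤ in a , zigzag-peaked , ascending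
  where
  last≤ : zigzag (suc k) (suc k + suc k) (pred (suc k + suc k)) ≤ suc (suc k)
  last≤ rewrite +-suc k k | zigzag-odd (suc k) (suc (suc (k + k))) k =
    m≤n+o⇒m∸n≤o (suc (suc (k + k))) k (≤-reflexive (sym (trans (+-suc k (suc k)) (cong suc (+-suc k k)))))
zigzagLabeling .(suc (suc k + suc k)) _ | odd (suc k) =
  let open Zigzag (suc (suc k)) (suc k) (s≤s z≤n) (n≤1+n _) ≤-refl last≤ in a , zigzag-peaked , ascending
  where
  last≤ : zigzag (suc (suc k)) (suc (suc k) + suc k) (suc k + suc k) ≤ suc (suc (suc k))
  last≤ rewrite zigzag-even (suc (suc k)) (suc (suc k) + suc k) (suc k) =
    ≤-trans (m∸n≤m (suc (suc k)) (suc k)) (n≤1+n _)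
zigzagLabeling .(0 + 0) () | even zero
zigzagLabeling .(suc (0 + 0)) (s≤s ()) | odd zero

insert : ℕ → ℕ → (ℕ → ℕ) → ℕ → ℕ
insert u v a i with <-cmp i u
... | tri< _ _ _ = a i
... | tri≈ _ _ _ = v
... | tri> _ _ _ = a (pred i)

insert-< : ∀ {u v a i} → i < u → insert u v a i ≡ a i
insert-< {u} {i = i} i<u with <-cmp i u
... | tri< _ _ _   = refl
... | tri≈ _ i≡u _ = contradiction i≡u (<⇒≢ i<u)
... | tri> _ _ u<i = contradiction i<u (<-asym u<i)

insert-≡ : ∀ {u v a} → insert u v a u ≡ v
insert-≡ {u} with <-cmp u u
... | tri< u<u _ _ = contradiction u<u (<-irrefl refl)
... | tri≈ _ _ _   = refl
... | tri> _ _ u<u = contradiction u<u (<-irrefl refl)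

insert-> : ∀ {u v a i} → u < i → insert u v a i ≡ a (pred i)
insert-> {u} {i = i} u<i with <-cmp i u
... | tri< i<u _ _ = contradiction u<i (<-asym i<u)
... | tri≈ _ i≡u _ = contradiction (sym i≡u) (<⇒≢ u<i)
... | tri> _ _ _   = refl

-- x is the position of y once the positions t, t+1, … have moved one step up
data Shifted (t : ℕ) : ℕ → ℕ → Set where
  kept  : ∀ {y} → y < t → Shifted t y y
  moved : ∀ {y} → t ≤ y → Shifted t y (suc y)

Shifted-functional : ∀ {t y x x′} → Shifted t y x → Shifted t y x′ → x ≡ x′
Shifted-functional (kept _)    (kept _)    = refl
Shifted-functional (moved _)   (moved _)   = refl
Shifted-functional (kept y<t)  (moved t≤y) = contradiction t≤y (<⇒≱ y<t)
Shifted-functional (moved t≤y) (kept y<t)  = contradiction t≤y (<⇒≱ y<t)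

insert-Shifted : ∀ {u v a j i} → Shifted u j i → insert u v a i ≡ a j
insert-Shifted (kept j<u)  = insert-< j<u
insert-Shifted (moved u≤j) = insert-> (s≤s u≤j)

-- Vertex u is the one split by the new edge u, so it has no counterpart.
innerSum-insert-Shifted : ∀ {u v a y x} → y ≢ u → Shifted (suc u) y x → innerSum (insert u v a) x ≡ innerSum a y
innerSum-insert-Shifted {u} {y = y} y≢u (kept y<1+u) =
  cong₂ _+_ (insert-< (≤-<-trans pred[n]≤n y<u)) (insert-< y<u)
  where
  y<u : y < u
  y<u = ≤∧≢⇒< (s≤s⁻¹ y<1+u) y≢u
innerSum-insert-Shifted _ (moved 1+u≤y) = cong₂ _+_ (insert-> 1+u≤y) (insert-> (≤-trans 1+u≤y (n≤1+n _)))

module Insertion {m u a} (L : PeakedLabeling m u a) where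
  open PeakedLabeling L

  a′ : ℕ → ℕ
  a′ = insert u (suc m) a

  a′-u : a′ u ≡ suc m
  a′-u = insert-≡ {u} {suc m} {a}

  a′-old : ∀ {j i} → Shifted u j i → a′ i ≡ a j
  a′-old = insert-Shifted {v = suc m} {a = a}

  data NewEdge (i : ℕ) : Set where
    new : i ≡ u → NewEdge i
    old : ∀ j → j < m → Shifted u j i → NewEdge i

  newEdge : ∀ i → i < suc m → NewEdge i
  newEdge i _ with <-cmp i u
  ... | tri< i<u _ _ = old i (<-trans i<u u<m) (kept i<u)
  ... | tri≈ _ i≡u _ = new i≡u
  newEdge (suc j) 1+j<1+m | tri> _ _ u<1+j = old j (s≤s⁻¹ 1+j<1+m) (moved (s≤s⁻¹ u<1+j))

  data NewVertex (x : ℕ) : Set where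
    left  : x ≡ u → NewVertex x
    right : x ≡ suc u → NewVertex x
    old   : ∀ y → 1 ≤ y → y < m → y ≢ u → Shifted (suc u) y x → NewVertex x

  newVertex : ∀ x → 1 ≤ x → x < suc m → NewVertex x
  newVertex x 1≤x _ with <-cmp x u
  ... | tri< x<u _ _ = old x 1≤x (<-trans x<u u<m) (<⇒≢ x<u) (kept (m≤n⇒m≤1+n x<u))
  ... | tri≈ _ x≡u _ = left x≡u
  ... | tri> _ _ u<x with m≤n⇒m<n∨m≡n u<x
  ...   | inj₂ 1+u≡x = right (sym 1+u≡x)
  newVertex (suc y) _ 1+y<1+m | tri> _ _ _ | inj₁ 1+u<1+y =
    old y (≤-trans (s≤s z≤n) u<y) (s≤s⁻¹ 1+y<1+m) (>⇒≢ u<y) (moved u<y)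
    where
    u<y : u < y
    u<y = s≤s⁻¹ 1+u<1+y

  label<1+m : ∀ i → i < m → a i < suc m
  label<1+m i i<m = s≤s (label≤m i i<m)

  1≤label′ : ∀ i → i < suc m → 1 ≤ a′ i
  1≤label′ i i<1+m with newEdge i i<1+m
  ... | new refl    = subst (1 ≤_) (sym a′-u) (s≤s z≤n)
  ... | old j j<m s = subst (1 ≤_) (sym (a′-old s)) (1≤label j j<m)

  label′≤1+m : ∀ i → i < suc m → a′ i ≤ suc m
  label′≤1+m i i<1+m with newEdge i i<1+m
  ... | new refl    = ≤-reflexive a′-u
  ... | old j j<m s = subst (_≤ suc m) (sym (a′-old s)) (m≤n⇒m≤1+n (label≤m j j<m))

  label′-inj : ∀ i i′ → i < suc m → i′ < suc m → a′ i ≡ a′ i′ → i ≡ i′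
  label′-inj i i′ p p′ eq with newEdge i p | newEdge i′ p′
  ... | new refl | new refl = refl
  ... | old j j<m s | old j′ j′<m s′ =
    Shifted-functional s (subst (λ k → Shifted u k i′) (sym (label-inj j j′ j<m j′<m
      (trans (sym (a′-old s)) (trans eq (a′-old s′))))) s′)
  ... | new refl | old j′ j′<m s′ =
    contradiction (trans (sym (a′-old s′)) (trans (sym eq) a′-u)) (<⇒≢ (label<1+m j′ j′<m))
  ... | old j j<m s | new refl =
    contradiction (trans (sym (a′-old s)) (trans eq a′-u)) (<⇒≢ (label<1+m j j<m))

  pred[u]<m : pred u < m
  pred[u]<m = ≤-<-trans pred[n]≤n u<m

  sum-left : innerSum a′ u ≡ a (pred u) + suc m
  sum-left = cong₂ _+_ (insert-< {u} {suc m} {a} (pred[n]<n 1≤u)) a′-u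

  sum-right : innerSum a′ (suc u) ≡ suc m + a u
  sum-right = cong₂ _+_ a′-u (insert-> {u} {suc m} {a} ≤-refl)

  sum-left≢sum-right : innerSum a′ u ≢ innerSum a′ (suc u)
  sum-left≢sum-right eq = <⇒≢ (pred[n]<n 1≤u) (label-inj (pred u) u pred[u]<m u<m
    (+-cancelʳ-≡ (suc m) (a (pred u)) (a u)
      (trans (sym sum-left) (trans eq (trans sum-right (+-comm (suc m) (a u)))))))

  ≤m⇒<sum-left : ∀ b → b ≤ m → b < innerSum a′ u
  ≤m⇒<sum-left b b≤m = subst (b <_) (sym sum-left) (≤-trans (s≤s b≤m) (m≤n+m (suc m) (a (pred u))))

  ≤m⇒<sum-right : ∀ b → b ≤ m → b < innerSum a′ (suc u)
  ≤m⇒<sum-right b b≤m = subst (b <_) (sym sum-right) (s≤s (≤-trans b≤m (m≤m+n m (a u))))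

  sum-old : ∀ {y x} → y ≢ u → Shifted (suc u) y x → innerSum a′ x ≡ innerSum a y
  sum-old = innerSum-insert-Shifted {v = suc m} {a = a}

  old<sum-left : ∀ {y x} → 1 ≤ y → y < m → y ≢ u → Shifted (suc u) y x → innerSum a′ x < innerSum a′ u
  old<sum-left {y} 1≤y y<m y≢u s = subst₂ _<_ (sym (sum-old y≢u s)) (sym sum-left)
    (≤-<-trans (sum≤peak y 1≤y y<m) (+-monoʳ-< (a (pred u)) (label<1+m u u<m)))

  old<sum-right : ∀ {y x} → 1 ≤ y → y < m → y ≢ u → Shifted (suc u) y x → innerSum a′ x < innerSum a′ (suc u)
  old<sum-right {y} 1≤y y<m y≢u s = subst₂ _<_ (sym (sum-old y≢u s)) (sym sum-right)
    (≤-<-trans (sum≤peak y 1≤y y<m) (+-monoˡ-< (a u) (label<1+m (pred u) pred[u]<m)))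

  sum′-inj : ∀ x x′ → 1 ≤ x → x < suc m → 1 ≤ x′ → x′ < suc m → innerSum a′ x ≡ innerSum a′ x′ → x ≡ x′
  sum′-inj x x′ 1≤x x<1+m 1≤x′ x′<1+m eq with newVertex x 1≤x x<1+m | newVertex x′ 1≤x′ x′<1+m
  ... | left refl  | left refl  = refl
  ... | right refl | right refl = refl
  ... | left refl  | right refl = contradiction eq sum-left≢sum-right
  ... | right refl | left refl  = contradiction (sym eq) sum-left≢sum-right
  ... | old y 1≤y y<m y≢u s | old y′ 1≤y′ y′<m y′≢u s′ =
    Shifted-functional s (subst (λ k → Shifted (suc u) k x′) (sym (sum-inj y y′ 1≤y y<m 1≤y′ y′<m
      (trans (sym (sum-old y≢u s)) (trans eq (sum-old y′≢u s′))))) s′)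
  ... | left refl  | old _ 1≤y y<m y≢u s = contradiction eq (>⇒≢ (old<sum-left 1≤y y<m y≢u s))
  ... | right refl | old _ 1≤y y<m y≢u s = contradiction eq (>⇒≢ (old<sum-right 1≤y y<m y≢u s))
  ... | old _ 1≤y y<m y≢u s | left refl  = contradiction eq (<⇒≢ (old<sum-left 1≤y y<m y≢u s))
  ... | old _ 1≤y y<m y≢u s | right refl = contradiction eq (<⇒≢ (old<sum-right 1≤y y<m y≢u s))

  <new-sums : ∀ b → b ≤ m → (∀ y → 1 ≤ y → y < m → b < innerSum a y) →
              ∀ x → 1 ≤ x → x < suc m → b < innerSum a′ x
  <new-sums b b≤m b<old x 1≤x x<1+m with newVertex x 1≤x x<1+m
  ... | left refl  = ≤m⇒<sum-left b b≤m
  ... | right refl = ≤m⇒<sum-right b b≤m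
  ... | old y 1≤y y<m y≢u s = subst (b <_) (sym (sum-old y≢u s)) (b<old y 1≤y y<m)

  peakedAt : ∀ p → 1 ≤ p → p < suc m → (∀ x → 1 ≤ x → x < suc m → innerSum a′ x ≤ innerSum a′ p) →
             PeakedLabeling (suc m) p a′
  peakedAt p 1≤p p<1+m sum≤p = record
    { 1≤u       = 1≤p
    ; u<m       = p<1+m
    ; 1≤label   = 1≤label′
    ; label≤m   = label′≤1+m
    ; label-inj = label′-inj
    ; sum-inj   = sum′-inj
    ; first<sum = λ x 1≤x x<1+m → subst (_< innerSum a′ x) (sym (insert-< {u} {suc m} {a} 1≤u))
                    (<new-sums (a 0) (label≤m 0 (<-trans 1≤u u<m)) first<sum x 1≤x x<1+m)
    ; last<sum  = λ x 1≤x x<1+m → subst (_< innerSum a′ x) (sym (insert-> {u} {suc m} {a} u<m))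
                    (<new-sums (a (pred m)) (label≤m (pred m) (pred[n]<n (<-trans 1≤u u<m))) last<sum x 1≤x x<1+m)
    ; sum≤peak  = sum≤p
    }

  insert-descending : a u < a (pred u) → PeakedLabeling (suc m) u a′ × a′ (pred u) < a′ u
  insert-descending a[u]<a[u-1] =
      peakedAt u 1≤u (m≤n⇒m≤1+n u<m) sum≤left
    , subst₂ _<_ (sym (insert-< {u} {suc m} {a} (pred[n]<n 1≤u))) (sym a′-u) (label<1+m (pred u) pred[u]<m)
    where
    sum≤left : ∀ x → 1 ≤ x → x < suc m → innerSum a′ x ≤ innerSum a′ u
    sum≤left x 1≤x x<1+m with newVertex x 1≤x x<1+m
    ... | left refl  = ≤-refl
    ... | right refl = subst₂ _≤_ (sym sum-right) (sym sum-left)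
                         (subst (_≤ a (pred u) + suc m) (+-comm (a u) (suc m)) (+-monoˡ-≤ (suc m) (<⇒≤ a[u]<a[u-1])))
    ... | old _ 1≤y y<m y≢u s = <⇒≤ (old<sum-left 1≤y y<m y≢u s)

  insert-ascending : a (pred u) < a u → PeakedLabeling (suc m) (suc u) a′ × a′ (suc u) < a′ u
  insert-ascending a[u-1]<a[u] =
      peakedAt (suc u) (s≤s z≤n) (s≤s u<m) sum≤right
    , subst₂ _<_ (sym (insert-> {u} {suc m} {a} ≤-refl)) (sym a′-u) (label<1+m u u<m)
    where
    sum≤right : ∀ x → 1 ≤ x → x < suc m → innerSum a′ x ≤ innerSum a′ (suc u)
    sum≤right x 1≤x x<1+m with newVertex x 1≤x x<1+m
    ... | right refl = ≤-refl
    ... | left refl  = subst₂ _≤_ (sym sum-left) (sym sum-right)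
                         (subst (a (pred u) + suc m ≤_) (+-comm (a u) (suc m)) (+-monoˡ-≤ (suc m) (<⇒≤ a[u-1]<a[u])))
    ... | old _ 1≤y y<m y≢u s = <⇒≤ (old<sum-right 1≤y y<m y≢u s)

reverse : ℕ → (ℕ → ℕ) → ℕ → ℕ
reverse m a i = a (m ∸ suc i)

innerSum-reverse : ∀ m a x → 1 ≤ x → innerSum (reverse m a) x ≡ innerSum a (m ∸ x)
innerSum-reverse m a (suc x) _ = begin
  a (m ∸ suc x) + a (m ∸ suc (suc x))       ≡⟨ +-comm (a (m ∸ suc x)) _ ⟩
  a (m ∸ suc (suc x)) + a (m ∸ suc x)       ≡⟨ cong (λ k → a k + a (m ∸ suc x)) (sym (pred[m∸n]≡m∸[1+n] m (suc x))) ⟩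
  a (pred (m ∸ suc x)) + a (m ∸ suc x)      ∎
  where open ≡-Reasoning

module _ {m u a} (L : PeakedLabeling m u a) where
  open PeakedLabeling L

  ∸<m : ∀ x → 1 ≤ x → x ≤ m → m ∸ x < m
  ∸<m x 1≤x x≤m = ∸-monoʳ-< {m} {x} {0} 1≤x x≤m

  reverse-peaked : PeakedLabeling m (m ∸ u) (reverse m a)
  reverse-peaked = record
    { 1≤u       = m<n⇒0<n∸m u<m
    ; u<m       = ∸<m u 1≤u (<⇒≤ u<m)
    ; 1≤label   = λ i i<m → 1≤label _ (∸<m (suc i) (s≤s z≤n) i<m)
    ; label≤m   = λ i i<m → label≤m _ (∸<m (suc i) (s≤s z≤n) i<m)
    ; label-inj = λ i j i<m j<m eq → suc-injective (∸-cancelˡ-≡ i<m j<m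
                    (label-inj _ _ (∸<m (suc i) (s≤s z≤n) i<m) (∸<m (suc j) (s≤s z≤n) j<m) eq))
    ; sum-inj   = λ x y 1≤x x<m 1≤y y<m eq → ∸-cancelˡ-≡ (<⇒≤ x<m) (<⇒≤ y<m)
                    (sum-inj _ _ (m<n⇒0<n∸m x<m) (∸<m x 1≤x (<⇒≤ x<m)) (m<n⇒0<n∸m y<m) (∸<m y 1≤y (<⇒≤ y<m))
                      (trans (sym (innerSum-reverse m a x 1≤x)) (trans eq (innerSum-reverse m a y 1≤y))))
    ; first<sum = λ x 1≤x x<m → subst₂ _<_ (cong a (pred[m∸n]≡m∸[1+n] m 0)) (sym (innerSum-reverse m a x 1≤x))
                    (last<sum _ (m<n⇒0<n∸m x<m) (∸<m x 1≤x (<⇒≤ x<m)))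
    ; last<sum  = λ x 1≤x x<m → subst₂ _<_ (cong a (sym m∸[1+pred[m]]≡0)) (sym (innerSum-reverse m a x 1≤x))
                    (first<sum _ (m<n⇒0<n∸m x<m) (∸<m x 1≤x (<⇒≤ x<m)))
    ; sum≤peak  = λ x 1≤x x<m → subst₂ _≤_ (sym (innerSum-reverse m a x 1≤x))
                    (trans (cong (innerSum a) (sym (m∸[m∸n]≡n (<⇒≤ u<m))))
                           (sym (innerSum-reverse m a (m ∸ u) (m<n⇒0<n∸m u<m))))
                    (sum≤peak _ (m<n⇒0<n∸m x<m) (∸<m x 1≤x (<⇒≤ x<m)))
    }
    where
    m∸[1+pred[m]]≡0 : m ∸ suc (pred m) ≡ 0
    m∸[1+pred[m]]≡0 = trans (cong (m ∸_) (suc-pred m ⦃ >-nonZero (<-trans 1≤u u<m) ⦄)) (n∸n≡0 m)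

-- each step inserts the two new largest labels m+1, m+2 next to the peak, moving it one vertex right
ascendingPeakedLabeling : ∀ m₀ → 2 ≤ m₀ → ∀ t →
  Σ (ℕ → ℕ) λ a → PeakedLabeling (t + t + m₀) (suc t) a × a t < a (suc t)
ascendingPeakedLabeling m₀ 2≤m₀ zero = zigzagLabeling m₀ 2≤m₀
ascendingPeakedLabeling m₀ 2≤m₀ (suc t) with ascendingPeakedLabeling m₀ 2≤m₀ t
... | a , L , asc =
  let L₁ , desc = Insertion.insert-ascending L asc
      L₂ , asc₂ = Insertion.insert-descending L₁ desc
  in Insertion.a′ L₁ , subst (λ m → PeakedLabeling m (suc (suc t)) (Insertion.a′ L₁)) size L₂ , asc₂
  where
  size : suc (suc (t + t + m₀)) ≡ suc t + suc t + m₀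
  size = cong (λ k → suc k + m₀) (sym (+-suc t t))

peakedLabeling-left : ∀ m u → 1 ≤ u → u + u ≤ m → Σ (ℕ → ℕ) (PeakedLabeling m u)
peakedLabeling-left m (suc t) _ 2+2t≤m =
  let a , L , _ = ascendingPeakedLabeling (m ∸ (t + t)) 2≤m∸2t t
  in a , subst (λ k → PeakedLabeling k (suc t) a) (m+[n∸m]≡n 2t≤m) L
  where
  2+2t≤m′ : 2 + (t + t) ≤ m
  2+2t≤m′ = subst (_≤ m) (cong suc (+-suc t t)) 2+2t≤m
  2t≤m : t + t ≤ m
  2t≤m = ≤-trans (m≤n+m (t + t) 2) 2+2t≤m′
  2≤m∸2t : 2 ≤ m ∸ (t + t)
  2≤m∸2t = subst (_≤ m ∸ (t + t)) (m+n∸n≡m 2 (t + t)) (∸-monoˡ-≤ (t + t) 2+2t≤m′)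

peakedLabeling : ∀ m u → 1 ≤ u → u < m → Σ (ℕ → ℕ) (PeakedLabeling m u)
peakedLabeling m u 1≤u u<m with u + u ≤? m
... | yes 2u≤m = peakedLabeling-left m u 1≤u 2u≤m
... | no 2u≰m =
  let a , L = peakedLabeling-left m (m ∸ u) (m<n⇒0<n∸m u<m) 2[m∸u]≤m
  in reverse m a , subst (λ v → PeakedLabeling m v (reverse m a)) (m∸[m∸n]≡n (<⇒≤ u<m)) (reverse-peaked L)
  where
  m∸u+u≡m : m ∸ u + u ≡ m
  m∸u+u≡m = m∸n+n≡m (<⇒≤ u<m)
  m∸u<u : m ∸ u < u
  m∸u<u = +-cancelʳ-< u (m ∸ u) u (subst (_< u + u) (sym m∸u+u≡m) (≰⇒> 2u≰m))
  2[m∸u]≤m : (m ∸ u) + (m ∸ u) ≤ m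
  2[m∸u]≤m = subst ((m ∸ u) + (m ∸ u) ≤_) m∸u+u≡m (<⇒≤ (+-monoʳ-< (m ∸ u) m∸u<u))

injective⇒surjective : ∀ {n} (f : Fin n → Fin n) → Injective _≡_ _≡_ f → Surjective _≡_ _≡_ f
injective⇒surjective {suc n} f f-inj y with Finₚ.any? (λ x → f x Finₚ.≟ y)
... | yes (x , fx≡y) = x , λ { refl → fx≡y }
... | no y∉im =
  let i , j , i<j , eq = Finₚ.pigeonhole (n<1+n n) (λ x → punchOut (y≢f x))
  in ⊥-elim (<-irrefl (cong toℕ (f-inj (Finₚ.punchOut-injective (y≢f i) (y≢f j) eq))) i<j)
  where
  y≢f : ∀ x → y ≢ f x
  y≢f x y≡fx = y∉im (x , sym y≡fx)

module _ {M a} {v : Fin (suc M)} (L : PeakedLabeling M (toℕ v) a) where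
  open PeakedLabeling L

  edgeLabeling : Fin M → Fin M
  edgeLabeling e = fromℕ< (<-≤-trans (pred[n]<n (1≤label (toℕ e) e<M)) (label≤m (toℕ e) e<M))
    where
    e<M : toℕ e < M
    e<M = Finₚ.toℕ<n e

  label-edgeLabeling : ∀ e → label edgeLabeling e ≡ a (toℕ e)
  label-edgeLabeling e = trans (cong suc (Finₚ.toℕ-fromℕ< _))
                               (suc-pred (a (toℕ e)) ⦃ >-nonZero (1≤label (toℕ e) (Finₚ.toℕ<n e)) ⦄)

  edgeLabeling-injective : Injective _≡_ _≡_ edgeLabeling
  edgeLabeling-injective {e} {e′} eq = Finₚ.toℕ-injective
    (label-inj (toℕ e) (toℕ e′) (Finₚ.toℕ<n e) (Finₚ.toℕ<n e′)
      (trans (sym (label-edgeLabeling e)) (trans (cong (suc ∘ toℕ) eq) (label-edgeLabeling e′))))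

  φ-Path : ∀ x → φ (Path (suc M)) edgeLabeling x ≡ pathSum M a (toℕ x)
  φ-Path x = trans (cong sum (map-cong label-edgeLabeling (incEdges (Path (suc M)) x))) (sum-incEdges-Path M a x)

  edgeLabeling-stronglyAntimagic : IsStronglyAntimagic (Path (suc M)) edgeLabeling
  edgeLabeling-stronglyAntimagic =
    ((edgeLabeling-injective , injective⇒surjective edgeLabeling edgeLabeling-injective) , antimagic) , strong
    where
    antimagic : ∀ x y → x ≢ y → φ (Path (suc M)) edgeLabeling x ≢ φ (Path (suc M)) edgeLabeling y
    antimagic x y x≢y eq = x≢y (Finₚ.toℕ-injective (pathSum-injective L (toℕ x) (toℕ y)
      (Finₚ.toℕ≤pred[n] x) (Finₚ.toℕ≤pred[n] y) (trans (sym (φ-Path x)) (trans eq (φ-Path y)))))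
    strong : ∀ x y → deg (Path (suc M)) x > deg (Path (suc M)) y →
             φ (Path (suc M)) edgeLabeling x > φ (Path (suc M)) edgeLabeling y
    strong x y deg> = subst₂ _>_ (sym (φ-Path x)) (sym (φ-Path y)) (degree<⇒pathSum< L (toℕ x) (toℕ y)
      (Finₚ.toℕ≤pred[n] x) (Finₚ.toℕ≤pred[n] y) (subst₂ _>_ (deg-Path M x) (deg-Path M y) deg>))

  edgeLabeling-peak : ∀ w → deg (Path (suc M)) w ≡ 2 →
                      φ (Path (suc M)) edgeLabeling w ≤ φ (Path (suc M)) edgeLabeling v
  edgeLabeling-peak w deg≡2 = subst₂ _≤_ (sym (φ-Path w)) (sym (φ-Path v))
    (pathSum≤peak L (toℕ w) (Finₚ.toℕ≤pred[n] w) (trans (sym (deg-Path M w)) deg≡2))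

lemma3p1 : (n : ℕ) → n ≥ 3 → (u : Fin n) → deg (Path n) u ≡ 2 →
    Σ (Fin (m (Path n)) → Fin (m (Path n))) (λ f →
      IsStronglyAntimagic (Path n) f ×
      (∀ (w : Fin n) → deg (Path n) w ≡ 2 → φ (Path n) f w ≤ φ (Path n) f u))
lemma3p1 (suc M@(suc (suc _))) (s≤s (s≤s (s≤s _))) u deg≡2 =
  let 1≤u , u<M = degree≡2⇒inner M (toℕ u) (s≤s z≤n) (Finₚ.toℕ≤pred[n] u) (trans (sym (deg-Path M u)) deg≡2)
      a , L     = peakedLabeling M (toℕ u) 1≤u u<M
  in edgeLabeling L , edgeLabeling-stronglyAntimagic L , edgeLabeling-peak L
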